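{- Let $H=(A,B,E)$ be an arbitrary bipartite graph, and let $d_v$ denote the degree of vertex $v$. If $0\leq x\leq 1$ and $y\geq 1$, or $0\leq y\leq 1$ and $x\geq 1$, then $$\widetilde{T}_H(x,y)\geq \prod_{i\in A}\left(1+\frac{x-1}{d_i+1}\right) \cdot \prod_{j\in B}\left(1+\frac{y-1}{d_j+1}\right).$$
   Context: A bipartite graph $H=(A,B,E)$ comes with designated sides $A,B$ (isolated vertices allowed). For $m=|V(H)|$ and a permutation $\pi$ of $V(H)$ (a bijection to $[m]$), a vertex $i\in A$ is internally active if $\pi(i)>\pi(j)$ for all neighbours $j$ of $i$, and $j\in B$ is externally active if $\pi(j)>\pi(i)$ for all neighbours $i$ of $j$ (vacuous for isolated vertices); $\mathrm{ia}(\pi),\mathrm{ea}(\pi)$ are their numbers, and $\widetilde{T}_H(x,y)=\frac{1}{m!}\sum_{\pi}x^{\mathrm{ia}(\pi)}y^{\mathrm{ea}(\pi)}$.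
   Formalization: The variables x and y range over the rationals. -}

module Defs where

open import Data.Bool using (Bool; true; false; _∧_; _∨_; not; if_then_else_)
open import Data.Nat as ℕ using (ℕ; zero; suc; _<ᵇ_; _≡ᵇ_)
open import Data.Nat.Base using (_!)
open import Data.Nat.Properties using (_!≢0)
open import Data.Fin using (Fin; toℕ; _↑ˡ_; _↑ʳ_)
open import Data.Fin.Properties using (_≟_)
open import Data.List using (List; []; _∷_; map; concatMap; foldr; allFin)
open import Data.Vec using (Vec; lookup) renaming ([] to []ᵛ; _∷_ to _∷ᵛ_)
open import Data.Integer using (+_)
open import Data.Rational using (ℚ; 0ℚ; 1ℚ; _+_; _*_; _-_; _/_)
open import Relation.Nullary.Decidable using (⌊_⌋)

record BipGraph (a b : ℕ) : Set where
  field
    adj : Fin a → Fin b → Bool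

open BipGraph public

vA : {a : ℕ} (b : ℕ) → Fin a → Fin (a ℕ.+ b)
vA b i = i ↑ˡ b

vB : (a : ℕ) {b : ℕ} → Fin b → Fin (a ℕ.+ b)
vB a j = a ↑ʳ j

allB : {X : Set} → (X → Bool) → List X → Bool
allB p [] = true
allB p (x ∷ xs) = p x ∧ allB p xs

filterB : {X : Set} → (X → Bool) → List X → List X
filterB p [] = []
filterB p (x ∷ xs) = if p x then x ∷ filterB p xs else filterB p xs

sumℚ : List ℚ → ℚ
sumℚ = foldr _+_ 0ℚ

prodℚ : List ℚ → ℚ
prodℚ = foldr _*_ 1ℚ

count : {X : Set} → (X → Bool) → List X → ℕ
count p [] = 0
count p (x ∷ xs) = if p x then suc (count p xs) else count p xs

_^_ : ℚ → ℕ → ℚ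
x ^ zero = 1ℚ
x ^ suc n = x * (x ^ n)

allVecs : (n k : ℕ) → List (Vec (Fin n) k)
allVecs n zero = []ᵛ ∷ []
allVecs n (suc k) = concatMap (λ x → map (x ∷ᵛ_) (allVecs n k)) (allFin n)

-- a map π : Fin m → Fin m (as a vector) is a bijection iff it is injective
isPerm : {m : ℕ} → Vec (Fin m) m → Bool
isPerm {m} π =
  allB (λ u → allB (λ v → not ⌊ lookup π u ≟ lookup π v ⌋ ∨ ⌊ u ≟ v ⌋) (allFin m)) (allFin m)

-- all permutations of V(H) = Fin m, i.e. bijections V(H) → [m]
perms : (m : ℕ) → List (Vec (Fin m) m)
perms m = filterB isPerm (allVecs m m)

module _ {a b : ℕ} (H : BipGraph a b) where

  private
    m = a ℕ.+ b

  rank : Vec (Fin m) m → Fin m → ℕ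
  rank π v = toℕ (lookup π v)

  internallyActive : Vec (Fin m) m → Fin a → Bool
  internallyActive π i =
    allB (λ j → not (adj H i j) ∨ (rank π (vB a j) <ᵇ rank π (vA b i))) (allFin b)

  externallyActive : Vec (Fin m) m → Fin b → Bool
  externallyActive π j =
    allB (λ i → not (adj H i j) ∨ (rank π (vA b i) <ᵇ rank π (vB a j))) (allFin a)

  ia : Vec (Fin m) m → ℕ
  ia π = count (internallyActive π) (allFin a)

  ea : Vec (Fin m) m → ℕ
  ea π = count (externallyActive π) (allFin b)

  degA : Fin a → ℕ
  degA i = count (λ j → adj H i j) (allFin b)

  degB : Fin b → ℕ
  degB j = count (λ i → adj H i j) (allFin a)

  inv-m! : ℚ
  inv-m! = _/_ (+ 1) (m !) {{m !≢0}}

  Ttilde : ℚ → ℚ → ℚ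
  Ttilde x y = inv-m! * sumℚ (map (λ π → (x ^ ia π) * (y ^ ea π)) (perms m))

  lowerBound : ℚ → ℚ → ℚ
  lowerBound x y =
    prodℚ (map (λ i → 1ℚ + (x - 1ℚ) * ((+ 1) / suc (degA i))) (allFin a))
    * prodℚ (map (λ j → 1ℚ + (y - 1ℚ) * ((+ 1) / suc (degB j))) (allFin b))

module Submission where

open import Defs
open import Data.Nat using (ℕ)
open import Data.Sum using (_⊎_)
open import Data.Product using (_×_)
open import Data.Rational using (ℚ; 0ℚ; 1ℚ; _≤_)

-- A vertex is active iff it is ranked above all its neighbours. Look at the lowest-ranked
-- vertex v: it is active iff it is isolated, and the active vertices among the others are
-- exactly those of H − v. This gives a recursion for m! T̃_H over the choice of v, and by
-- induction each H − v contributes at least (m − 1)! times its own product of factors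
-- 1 + (w − 1)/(d + 1). Deleting v lowers the degree of each neighbour u of v by one, which
-- multiplies the factor of u by 1 + r_u. The neighbours of v lie on the other side, so these
-- r_u share a sign, opposite to that of r_v: the Weierstrass product inequality
-- ∏ (1 + r_u) ≥ 1 + ∑ r_u applies, the cross term d_v r_v ∑ r_u is ≤ 0, and the remaining
-- linear terms cancel in the sum over v by double counting the edges.

open import Algebra.Bundles using (Monoid; CommutativeMonoid; CommutativeRing)
import Algebra.Properties.Monoid.Sum as MonoidSum
import Algebra.Properties.Semiring.Mult as SemiringMult
open import Data.Bool using (Bool; true; false; not; _∧_; _∨_; if_then_else_; T)
import Data.Bool.Properties as Boolₚ
open import Data.Empty using (⊥-elim)
open import Data.Fin as Fin using (Fin; punchIn; toℕ; _↑ˡ_; _↑ʳ_; splitAt)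
import Data.Fin.Properties as Finₚ
import Data.Integer as ℤ
import Data.Integer.Properties as ℤₚ
open import Data.List as List using (List; []; _∷_; _++_; concatMap; tabulate; allFin)
open import Data.Nat as ℕ using (zero; suc; _<ᵇ_; _≡ᵇ_; _!)
import Data.Nat.Coprimality as Coprime
import Data.Nat.Properties as ℕₚ
open ℕₚ using (_!≢0)
open import Data.Product using (_,_; proj₁; proj₂)
open import Data.Rational
  using (_+_; _*_; _-_; -_; _/_; 1/_; mkℚ; _<_; _≟_; Positive; nonNegative; nonPositive; positive; ≢-nonZero)
open import Data.Rational.Properties
  using ( ↥p/↧p≡p; *-inverseʳ; ≤-refl; ≤-trans; ≤-reflexive; <⇒≤; <⇒≢; <-≤-trans; module ≤-Reasoning
        ; +-mono-≤; +-monoʳ-≤; +-monoˡ-≤; neg-antimono-≤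
        ; *-monoʳ-≤-nonNeg; *-monoˡ-≤-nonNeg; *-monoʳ-≤-nonPos
        ; nonNegative⁻¹; positive⁻¹; pos⇒nonNeg; 1/pos⇒pos; nonNeg∧nonZero⇒pos; pos*pos⇒pos
        ; normalize-pos; normalize-nonNeg
        ; +-identityˡ; +-identityʳ; +-assoc; *-identityˡ; *-identityʳ; *-assoc; *-comm; *-zeroˡ; *-zeroʳ
        ; neg-distrib-+; +-0-commutativeMonoid; *-1-commutativeMonoid; +-*-commutativeRing)
open import Data.Rational.Solver using (module +-*-Solver)
open import Data.Sum using (inj₁; inj₂; [_,_]′)
open import Data.Vec as Vec using (Vec; []; _∷_; lookup)
import Data.Vec.Properties as Vecₚ
open import Function using (_∘_; const)
open import Function.Bundles using (Equivalence; _⇔_; mk⇔)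
open import Function.Definitions using (Injective)
open import Relation.Binary.PropositionalEquality
open import Relation.Nullary using (yes; no; does)
open import Relation.Nullary.Decidable using (⌊_⌋)
import Relation.Nullary.Reflects as Reflects
open Reflects using (Reflects)

open import Algebra.Properties.CommutativeMonoid.Sum +-0-commutativeMonoid
  using (∑-comm; ∑-distrib-+)
  renaming (sum to ∑; sum-cong-≗ to ∑-cong; sum-remove to ∑-remove; sum-replicate-zero to ∑-zero)
open import Algebra.Properties.CommutativeMonoid.Sum *-1-commutativeMonoid
  using () renaming (sum to ∏; sum-cong-≗ to ∏-cong; sum-remove to ∏-remove; ∑-distrib-+ to ∏-distrib-*)
open import Algebra.Properties.CommutativeMonoid.Sum Boolₚ.∧-commutativeMonoid
  using () renaming (sum to ⋀; sum-cong-≗ to ⋀-cong; sum-remove to ⋀-remove; sum-replicate-zero to ⋀-true)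
open import Algebra.Properties.CommutativeMonoid.Sum ℕₚ.+-0-commutativeMonoid
  using ()
  renaming (sum to ∑ℕ; sum-cong-≗ to ∑ℕ-cong; sum-remove to ∑ℕ-remove; sum-replicate-zero to ∑ℕ-zero)
open import Algebra.Properties.Semiring.Sum (CommutativeRing.semiring +-*-commutativeRing)
  using (*-distribˡ-sum)
module ℚ-Mult = SemiringMult (CommutativeRing.semiring +-*-commutativeRing)
open +-*-Solver using (solve; _:+_; _:*_; _:-_; :-_; con; _:=_)

fromℕ : ℕ → ℚ
fromℕ n = n ℚ-Mult.× 1ℚ

n/1≡mkℚ : ∀ n → ℤ.+ n / 1 ≡ mkℚ (ℤ.+ n) 0 (Coprime.sym (Coprime.1-coprimeTo n))
n/1≡mkℚ n = ↥p/↧p≡p (mkℚ (ℤ.+ n) 0 (Coprime.sym (Coprime.1-coprimeTo n)))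

fromℕ≡n/1 : ∀ n → fromℕ n ≡ ℤ.+ n / 1
fromℕ≡n/1 zero    = refl
fromℕ≡n/1 (suc n) rewrite fromℕ≡n/1 n | n/1≡mkℚ n =
  cong (_/ 1) (cong (ℤ._+_ (ℤ.+ 1)) (ℤₚ.*-identityʳ (ℤ.+ n)))

fromℕ*1/n≡1 : ∀ n .{{_ : ℕ.NonZero n}} → fromℕ n * (ℤ.+ 1 / n) ≡ 1ℚ
fromℕ*1/n≡1 (suc k) rewrite fromℕ≡n/1 (suc k) | n/1≡mkℚ (suc k)
                          | ↥p/↧p≡p (mkℚ (ℤ.+ 1) k (Coprime.1-coprimeTo (suc k))) =
  *-inverseʳ (mkℚ (ℤ.+ suc k) 0 (Coprime.sym (Coprime.1-coprimeTo (suc k))))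

fromℕ≥0 : ∀ n → 0ℚ ≤ fromℕ n
fromℕ≥0 zero    = ≤-refl
fromℕ≥0 (suc n) = +-mono-≤ (nonNegative⁻¹ 1ℚ) (fromℕ≥0 n)

-- A total reciprocal (inv 0ℚ = 0ℚ), so that dropRatio needs no nonzeroness proof; the lemmas
-- about dropRatio only ever invert positive activity factors.
inv : ℚ → ℚ
inv p with p ≟ 0ℚ
... | yes _   = 0ℚ
... | no p≢0 = 1/ p  where instance _ = ≢-nonZero p≢0

*-invʳ : ∀ p → p ≢ 0ℚ → p * inv p ≡ 1ℚ
*-invʳ p p≢0 with p ≟ 0ℚ
... | yes p≡0  = ⊥-elim (p≢0 p≡0)
... | no p≢0′ = *-inverseʳ p where instance _ = ≢-nonZero p≢0′

inv≥0 : ∀ {p} → 0ℚ ≤ p → 0ℚ ≤ inv p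
inv≥0 {p} 0≤p with p ≟ 0ℚ
... | yes _   = ≤-refl
... | no p≢0 = nonNegative⁻¹ 1/p {{pos⇒nonNeg 1/p {{1/pos⇒pos p {{p>0}}}}}}
  where
  1/p : ℚ
  1/p = (1/ p) {{≢-nonZero p≢0}}
  p>0 : Positive p
  p>0 = nonNeg∧nonZero⇒pos p {{nonNegative 0≤p}} {{≢-nonZero p≢0}}

p≤p+q : ∀ p {q} → 0ℚ ≤ q → p ≤ p + q
p≤p+q p 0≤q = ≤-trans (≤-reflexive (sym (+-identityʳ p))) (+-monoʳ-≤ p 0≤q)

Signed : Bool → ℚ → Set
Signed true  q = q ≤ 0ℚ
Signed false q = 0ℚ ≤ q

signed-0 : ∀ b → Signed b 0ℚ
signed-0 true  = ≤-refl
signed-0 false = ≤-refl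

signed-+ : ∀ b {p q} → Signed b p → Signed b q → Signed b (p + q)
signed-+ true  = +-mono-≤
signed-+ false = +-mono-≤

signed-∑ : ∀ b {n} (f : Fin n → ℚ) → (∀ i → Signed b (f i)) → Signed b (∑ f)
signed-∑ b {zero}  f sf = signed-0 b
signed-∑ b {suc n} f sf = signed-+ b (sf Fin.zero) (signed-∑ b (f ∘ Fin.suc) (sf ∘ Fin.suc))

signed-*-nonNeg : ∀ b {p q} → Signed b p → 0ℚ ≤ q → Signed b (p * q)
signed-*-nonNeg true  {p} {q} p≤0 0≤q =
  ≤-trans (*-monoʳ-≤-nonNeg q {{nonNegative 0≤q}} p≤0) (≤-reflexive (*-zeroˡ q))
signed-*-nonNeg false {p} {q} 0≤p 0≤q =
  ≤-trans (≤-reflexive (sym (*-zeroˡ q))) (*-monoʳ-≤-nonNeg q {{nonNegative 0≤q}} 0≤p)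

same-sign⇒*≥0 : ∀ b {p q} → Signed b p → Signed b q → 0ℚ ≤ p * q
same-sign⇒*≥0 true  {p} {q} p≤0 q≤0 =
  ≤-trans (≤-reflexive (sym (*-zeroˡ q))) (*-monoʳ-≤-nonPos q {{nonPositive q≤0}} p≤0)
same-sign⇒*≥0 false 0≤p 0≤q = signed-*-nonNeg false 0≤p 0≤q

opposite-sign⇒*≤0 : ∀ b {p q} → Signed b p → Signed (not b) q → p * q ≤ 0ℚ
opposite-sign⇒*≤0 true  p≤0 0≤q = signed-*-nonNeg true p≤0 0≤q
opposite-sign⇒*≤0 false {p} {q} 0≤p q≤0 =
  ≤-trans (≤-reflexive (*-comm p q)) (signed-*-nonNeg true q≤0 0≤p)

1+∑≤∏1+ : ∀ b {n} (f : Fin n → ℚ) → (∀ i → Signed b (f i)) → (∀ i → 0ℚ ≤ 1ℚ + f i) →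
          1ℚ + ∑ f ≤ ∏ (λ i → 1ℚ + f i)
1+∑≤∏1+ b {zero}  f _  _      = ≤-reflexive (+-identityʳ 1ℚ)
1+∑≤∏1+ b {suc n} f sf 1+f≥0 = begin
  1ℚ + (t + S)
    ≤⟨ p≤p+q (1ℚ + (t + S)) (same-sign⇒*≥0 b (sf Fin.zero) (signed-∑ b (f ∘ Fin.suc) (sf ∘ Fin.suc))) ⟩
  1ℚ + (t + S) + t * S
    ≡⟨ solve 2 (λ t S → con 1ℚ :+ (t :+ S) :+ t :* S := (con 1ℚ :+ t) :* (con 1ℚ :+ S)) refl t S ⟩
  (1ℚ + t) * (1ℚ + S)
    ≤⟨ *-monoˡ-≤-nonNeg (1ℚ + t) {{nonNegative (1+f≥0 Fin.zero)}}
         (1+∑≤∏1+ b (f ∘ Fin.suc) (sf ∘ Fin.suc) (1+f≥0 ∘ Fin.suc)) ⟩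
  (1ℚ + t) * ∏ (λ i → 1ℚ + f (Fin.suc i)) ∎
  where
  open ≤-Reasoning
  t S : ℚ
  t = f Fin.zero
  S = ∑ (f ∘ Fin.suc)

∑-*ˡ : ∀ {n} c (f : Fin n → ℚ) → ∑ (λ i → c * f i) ≡ c * ∑ f
∑-*ˡ c f = sym (*-distribˡ-sum c f)

∑-mono-≤ : ∀ {n} {f g : Fin n → ℚ} → (∀ i → f i ≤ g i) → ∑ f ≤ ∑ g
∑-mono-≤ {zero}  f≤g = ≤-refl
∑-mono-≤ {suc n} f≤g = +-mono-≤ (f≤g Fin.zero) (∑-mono-≤ (f≤g ∘ Fin.suc))

∑-neg : ∀ {n} (f : Fin n → ℚ) → ∑ (λ i → - f i) ≡ - ∑ f
∑-neg {zero}  f = refl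
∑-neg {suc n} f =
  trans (cong (λ s → - f Fin.zero + s) (∑-neg (f ∘ Fin.suc))) (sym (neg-distrib-+ (f Fin.zero) _))

∑-const-1 : ∀ n → ∑ {n} (λ _ → 1ℚ) ≡ fromℕ n
∑-const-1 zero    = refl
∑-const-1 (suc n) = cong (1ℚ +_) (∑-const-1 n)

∏≥0 : ∀ {n} {f : Fin n → ℚ} → (∀ i → 0ℚ ≤ f i) → 0ℚ ≤ ∏ f
∏≥0 {zero}  _    = nonNegative⁻¹ 1ℚ
∏≥0 {suc n} f≥0 = signed-*-nonNeg false (f≥0 Fin.zero) (∏≥0 (f≥0 ∘ Fin.suc))

[_]·_ : Bool → ℚ → ℚ
[ true  ]· q = q
[ false ]· q = 0ℚ

[∧]· : ∀ a b q → [ a ∧ b ]· q ≡ [ a ]· [ b ]· q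
[∧]· true  b q = refl
[∧]· false b q = refl

[∧]·-swap : ∀ a b q → [ a ∧ b ]· q ≡ [ b ]· [ a ]· q
[∧]·-swap true  b     q = refl
[∧]·-swap false true  q = refl
[∧]·-swap false false q = refl

indicator : Bool → ℕ
indicator b = if b then 1 else 0

fromℕ-count*≡∑ : ∀ {n} (p : Fin n → Bool) q →
                 fromℕ (∑ℕ (indicator ∘ p)) * q ≡ ∑ (λ t → [ p t ]· q)
fromℕ-count*≡∑ {zero}  p q = *-zeroˡ q
fromℕ-count*≡∑ {suc n} p q with p Fin.zero
... | true  = trans (solve 2 (λ c q → (con 1ℚ :+ c) :* q := q :+ c :* q) refl (fromℕ (∑ℕ (indicator ∘ p ∘ Fin.suc))) q)
                    (cong (q +_) (fromℕ-count*≡∑ (p ∘ Fin.suc) q))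
... | false = trans (fromℕ-count*≡∑ (p ∘ Fin.suc) q) (sym (+-identityˡ _))

1/suc : ℕ → ℚ
1/suc d = ℤ.+ 1 / suc d

1/suc>0 : ∀ d → 0ℚ < 1/suc d
1/suc>0 d = positive⁻¹ (1/suc d) {{normalize-pos 1 (suc d)}}

suc*1/suc≡1 : ∀ d → fromℕ (suc d) * 1/suc d ≡ 1ℚ
suc*1/suc≡1 d = fromℕ*1/n≡1 (suc d)

1/suc-gap : ∀ k → 1/suc k - 1/suc (suc k) ≡ 1/suc k * 1/suc (suc k)
1/suc-gap k = begin
  h₀ - h₁
    ≡⟨ cong₂ _-_ (sym (*-identityʳ h₀)) (sym (*-identityʳ h₁)) ⟩
  h₀ * 1ℚ - h₁ * 1ℚ
    ≡⟨ cong₂ (λ x y → h₀ * x - h₁ * y) (sym (suc*1/suc≡1 (suc k))) (sym (suc*1/suc≡1 k)) ⟩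
  h₀ * ((1ℚ + K) * h₁) - h₁ * (K * h₀)
    ≡⟨ solve 3 (λ h₀ h₁ K → h₀ :* ((con 1ℚ :+ K) :* h₁) :- h₁ :* (K :* h₀) := h₀ :* h₁) refl h₀ h₁ K ⟩
  h₀ * h₁ ∎
  where
  open ≡-Reasoning
  h₀ h₁ K : ℚ
  h₀ = 1/suc k
  h₁ = 1/suc (suc k)
  K  = fromℕ (suc k)

activityFactor : ℕ → ℚ → ℚ
activityFactor d w = 1ℚ + (w - 1ℚ) * 1/suc d

activityFactor-zero : ∀ w → activityFactor 0 w ≡ w
activityFactor-zero w = solve 1 (λ w → con 1ℚ :+ (w :- con 1ℚ) :* con 1ℚ := w) refl w

activityFactor≡ : ∀ d w → activityFactor d w ≡ (fromℕ d + w) * 1/suc d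
activityFactor≡ d w = begin
  1ℚ + (w - 1ℚ) * h
    ≡⟨ cong (_+ (w - 1ℚ) * h) (sym (suc*1/suc≡1 d)) ⟩
  (1ℚ + D) * h + (w - 1ℚ) * h
    ≡⟨ solve 3 (λ D w h → (con 1ℚ :+ D) :* h :+ (w :- con 1ℚ) :* h := (D :+ w) :* h) refl D w h ⟩
  (D + w) * h ∎
  where
  open ≡-Reasoning
  h D : ℚ
  h = 1/suc d
  D = fromℕ d

activityFactor≥0 : ∀ d {w} → 0ℚ ≤ w → 0ℚ ≤ activityFactor d w
activityFactor≥0 d {w} 0≤w = subst (0ℚ ≤_) (sym (activityFactor≡ d w))
  (signed-*-nonNeg false (+-mono-≤ (fromℕ≥0 d) 0≤w) (<⇒≤ (1/suc>0 d)))

activityFactor>0 : ∀ k {w} → 0ℚ ≤ w → 0ℚ < activityFactor (suc k) w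
activityFactor>0 k {w} 0≤w = subst (0ℚ <_) (sym (activityFactor≡ (suc k) w))
  (positive⁻¹ ((K + w) * h) {{pos*pos⇒pos (K + w) {{positive K+w>0}} h {{positive (1/suc>0 (suc k))}}}})
  where
  K h : ℚ
  K = fromℕ (suc k)
  h = 1/suc (suc k)
  K+w>0 : 0ℚ < K + w
  K+w>0 = <-≤-trans (positive⁻¹ 1ℚ) (≤-trans (p≤p+q 1ℚ (fromℕ≥0 k)) (p≤p+q K 0≤w))

dropRatio : ℕ → ℚ → ℚ
dropRatio zero    w = 0ℚ
dropRatio (suc k) w = (activityFactor k w - activityFactor (suc k) w) * inv (activityFactor (suc k) w)

loneWeight : ℕ → ℚ → ℚ
loneWeight d w = if d ≡ᵇ 0 then w else 1ℚ

module _ (k : ℕ) {w : ℚ} (0≤w : 0ℚ ≤ w) where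
  private
    f F I K : ℚ
    f = activityFactor k w
    F = activityFactor (suc k) w
    I = inv F
    K = fromℕ (suc k)
    open ≡-Reasoning

  activityFactor*inv≡1 : F * I ≡ 1ℚ
  activityFactor*inv≡1 = *-invʳ F (λ F≡0 → <⇒≢ (activityFactor>0 k 0≤w) (sym F≡0))

  activityFactor-pred : f ≡ F * (1ℚ + dropRatio (suc k) w)
  activityFactor-pred = sym (begin
    F * (1ℚ + (f - F) * I)
      ≡⟨ solve 3 (λ F f I → F :* (con 1ℚ :+ (f :- F) :* I) := F :+ (f :- F) :* (F :* I)) refl F f I ⟩
    F + (f - F) * (F * I)
      ≡⟨ cong (λ x → F + (f - F) * x) activityFactor*inv≡1 ⟩
    F + (f - F) * 1ℚ
      ≡⟨ solve 2 (λ F f → F :+ (f :- F) :* con 1ℚ := f) refl F f ⟩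
    f                         ∎)

  1+dropRatio≡ : 1ℚ + dropRatio (suc k) w ≡ f * I
  1+dropRatio≡ = begin
    1ℚ + (f - F) * I
      ≡⟨ cong (λ x → x + (f - F) * I) (sym activityFactor*inv≡1) ⟩
    F * I + (f - F) * I
      ≡⟨ solve 3 (λ F f I → F :* I :+ (f :- F) :* I := f :* I) refl F f I ⟩
    f * I ∎

  1-suc*dropRatio≡ : 1ℚ - K * dropRatio (suc k) w ≡ I
  1-suc*dropRatio≡ = begin
    1ℚ - K * ((f - F) * I)
      ≡⟨ solve 4 (λ K f F I → con 1ℚ :- K :* ((f :- F) :* I) := con 1ℚ :- (K :* (f :- F)) :* I) refl K f F I ⟩
    1ℚ - (K * (f - F)) * I
      ≡⟨ cong (λ x → 1ℚ - x * I) K*[f-F]≡F-1 ⟩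
    1ℚ - (F - 1ℚ) * I
      ≡⟨ solve 2 (λ F I → con 1ℚ :- (F :- con 1ℚ) :* I := I :+ (con 1ℚ :- F :* I)) refl F I ⟩
    I + (1ℚ - F * I)
      ≡⟨ cong (λ x → I + (1ℚ - x)) activityFactor*inv≡1 ⟩
    I + (1ℚ - 1ℚ)
      ≡⟨ solve 1 (λ I → I :+ (con 1ℚ :- con 1ℚ) := I) refl I ⟩
    I ∎
    where
    h₀ h₁ : ℚ
    h₀ = 1/suc k
    h₁ = 1/suc (suc k)
    K*[f-F]≡F-1 : K * (f - F) ≡ F - 1ℚ
    K*[f-F]≡F-1 = begin
      K * (f - F)
        ≡⟨ solve 4 (λ K w h₀ h₁ → K :* ((con 1ℚ :+ (w :- con 1ℚ) :* h₀) :- (con 1ℚ :+ (w :- con 1ℚ) :* h₁))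
             := (w :- con 1ℚ) :* (K :* h₀ :- K :* h₁)) refl K w h₀ h₁ ⟩
      (w - 1ℚ) * (K * h₀ - K * h₁)
        ≡⟨ cong (λ x → (w - 1ℚ) * (x - K * h₁)) (suc*1/suc≡1 k) ⟩
      (w - 1ℚ) * (1ℚ - K * h₁)
        ≡⟨ cong (λ x → (w - 1ℚ) * (x - K * h₁)) (sym (suc*1/suc≡1 (suc k))) ⟩
      (w - 1ℚ) * ((1ℚ + K) * h₁ - K * h₁)
        ≡⟨ solve 3 (λ w K h₁ → (w :- con 1ℚ) :* ((con 1ℚ :+ K) :* h₁ :- K :* h₁)
             := (con 1ℚ :+ (w :- con 1ℚ) :* h₁) :- con 1ℚ) refl w K h₁ ⟩
      F - 1ℚ ∎

loneWeight≡ : ∀ d {w} → 0ℚ ≤ w → loneWeight d w ≡ activityFactor d w * (1ℚ - fromℕ d * dropRatio d w)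
loneWeight≡ zero    {w} _   = sym (trans (cong (_* 1ℚ) (activityFactor-zero w)) (*-identityʳ w))
loneWeight≡ (suc k) {w} 0≤w =
  sym (trans (cong (activityFactor (suc k) w *_) (1-suc*dropRatio≡ k 0≤w)) (activityFactor*inv≡1 k 0≤w))

loneWeight≥0 : ∀ d {w} → 0ℚ ≤ w → 0ℚ ≤ loneWeight d w
loneWeight≥0 zero    0≤w = 0≤w
loneWeight≥0 (suc _) _   = nonNegative⁻¹ 1ℚ

1-d*dropRatio≥0 : ∀ d {w} → 0ℚ ≤ w → 0ℚ ≤ 1ℚ - fromℕ d * dropRatio d w
1-d*dropRatio≥0 zero    _   = nonNegative⁻¹ 1ℚ
1-d*dropRatio≥0 (suc k) 0≤w =
  subst (0ℚ ≤_) (sym (1-suc*dropRatio≡ k 0≤w)) (inv≥0 (activityFactor≥0 (suc k) 0≤w))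

1+dropRatio≥0 : ∀ d {w} → 0ℚ ≤ w → 0ℚ ≤ 1ℚ + dropRatio d w
1+dropRatio≥0 zero    _   = nonNegative⁻¹ 1ℚ
1+dropRatio≥0 (suc k) 0≤w = subst (0ℚ ≤_) (sym (1+dropRatio≡ k 0≤w))
  (signed-*-nonNeg false (activityFactor≥0 k 0≤w) (inv≥0 (activityFactor≥0 (suc k) 0≤w)))

dropRatio-sign : ∀ b d {w} → 0ℚ ≤ w → Signed b (w - 1ℚ) → Signed b (dropRatio d w)
dropRatio-sign b zero    _   _  = signed-0 b
dropRatio-sign b (suc k) {w} 0≤w sw =
  signed-*-nonNeg b (subst (Signed b) (sym f-F≡) (signed-*-nonNeg b sw h₀h₁≥0))
                    (inv≥0 (activityFactor≥0 (suc k) 0≤w))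
  where
  h₀ h₁ : ℚ
  h₀ = 1/suc k
  h₁ = 1/suc (suc k)
  h₀h₁≥0 : 0ℚ ≤ h₀ * h₁
  h₀h₁≥0 = signed-*-nonNeg false (<⇒≤ (1/suc>0 k)) (<⇒≤ (1/suc>0 (suc k)))
  f-F≡ : activityFactor k w - activityFactor (suc k) w ≡ (w - 1ℚ) * (h₀ * h₁)
  f-F≡ = trans (solve 3 (λ w h₀ h₁ → (con 1ℚ :+ (w :- con 1ℚ) :* h₀) :- (con 1ℚ :+ (w :- con 1ℚ) :* h₁)
                                     := (w :- con 1ℚ) :* (h₀ :- h₁)) refl w h₀ h₁)
               (cong ((w - 1ℚ) *_) (1/suc-gap k))

∑vec : ∀ N k → (Vec (Fin N) k → ℚ) → ℚ
∑vec N zero    f = f []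
∑vec N (suc k) f = ∑ λ x → ∑vec N k (f ∘ (x ∷_))

∑vec-cong : ∀ {N} k {f g : Vec (Fin N) k → ℚ} → (∀ π → f π ≡ g π) → ∑vec N k f ≡ ∑vec N k g
∑vec-cong zero    f≗g = f≗g []
∑vec-cong {N} (suc k) f≗g = ∑-cong {N} (λ x → ∑vec-cong k (f≗g ∘ (x ∷_)))

∑vec-zero : ∀ N k → ∑vec N k (λ _ → 0ℚ) ≡ 0ℚ
∑vec-zero N zero    = refl
∑vec-zero N (suc k) = trans (∑-cong {N} (λ _ → ∑vec-zero N k)) (∑-zero N)

∑vec-*ˡ : ∀ {N} k c (f : Vec (Fin N) k → ℚ) → ∑vec N k (λ π → c * f π) ≡ c * ∑vec N k f
∑vec-*ˡ     zero    c f = refl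
∑vec-*ˡ {N} (suc k) c f =
  trans (∑-cong {N} (λ x → ∑vec-*ˡ k c (f ∘ (x ∷_)))) (∑-*ˡ c (λ x → ∑vec N k (f ∘ (x ∷_))))

_∉ᵇ_ : ∀ {N k} → Fin N → Vec (Fin N) k → Bool
d ∉ᵇ []      = true
d ∉ᵇ (e ∷ π) = not (does (e Finₚ.≟ d)) ∧ d ∉ᵇ π

distinct : ∀ {N k} → Vec (Fin N) k → Bool
distinct []      = true
distinct (d ∷ π) = d ∉ᵇ π ∧ distinct π

∑distinct : ∀ N k → (Vec (Fin N) k → ℚ) → ℚ
∑distinct N k f = ∑vec N k (λ π → [ distinct π ]· f π)

∑distinct-*ˡ : ∀ {N} k c (f : Vec (Fin N) k → ℚ) → ∑distinct N k (λ π → c * f π) ≡ c * ∑distinct N k f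
∑distinct-*ˡ k c f = trans (∑vec-cong k (λ π → []·-*ˡ (distinct π))) (∑vec-*ˡ k c _)
  where
  []·-*ˡ : ∀ b {q} → [ b ]· (c * q) ≡ c * [ b ]· q
  []·-*ˡ true  = refl
  []·-*ˡ false = sym (*-zeroʳ c)

insertMin : ∀ {n k} → Fin (suc k) → Vec (Fin n) k → Vec (Fin (suc n)) (suc k)
insertMin Fin.zero    τ       = Fin.zero ∷ Vec.map Fin.suc τ
insertMin (Fin.suc v) (e ∷ τ) = Fin.suc e ∷ insertMin v τ

suc∉ᵇmap-suc : ∀ {N k} (e : Fin N) (τ : Vec (Fin N) k) → (Fin.suc e ∉ᵇ Vec.map Fin.suc τ) ≡ (e ∉ᵇ τ)
suc∉ᵇmap-suc e []      = refl
suc∉ᵇmap-suc e (d ∷ τ) = cong₂ _∧_ refl (suc∉ᵇmap-suc e τ)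

distinct-map-suc : ∀ {N k} (τ : Vec (Fin N) k) → distinct (Vec.map Fin.suc τ) ≡ distinct τ
distinct-map-suc []      = refl
distinct-map-suc (d ∷ τ) = cong₂ _∧_ (suc∉ᵇmap-suc d τ) (distinct-map-suc τ)

suc∉ᵇinsertMin : ∀ {N k} (e : Fin N) (v : Fin (suc k)) (τ : Vec (Fin N) k) →
                 (Fin.suc e ∉ᵇ insertMin v τ) ≡ (e ∉ᵇ τ)
suc∉ᵇinsertMin e Fin.zero    τ       = suc∉ᵇmap-suc e τ
suc∉ᵇinsertMin e (Fin.suc v) (d ∷ τ) = cong₂ _∧_ refl (suc∉ᵇinsertMin e v τ)

∑vec-avoiding-zero : ∀ {n} k (g : Vec (Fin (suc n)) k → ℚ) →
                     ∑vec (suc n) k (λ π → [ Fin.zero ∉ᵇ π ]· g π) ≡ ∑vec n k (g ∘ Vec.map Fin.suc)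
∑vec-avoiding-zero     zero    g = refl
∑vec-avoiding-zero {n} (suc k) g = begin
  ∑vec (suc n) k (λ _ → 0ℚ) + ∑ (λ e → ∑vec (suc n) k (λ π → [ Fin.zero ∉ᵇ π ]· g (Fin.suc e ∷ π)))
    ≡⟨ cong₂ _+_ (∑vec-zero (suc n) k) (∑-cong {n} (λ e → ∑vec-avoiding-zero k (g ∘ (Fin.suc e ∷_)))) ⟩
  0ℚ + ∑vec n (suc k) (g ∘ Vec.map Fin.suc)
    ≡⟨ +-identityˡ _ ⟩
  ∑vec n (suc k) (g ∘ Vec.map Fin.suc) ∎
  where open ≡-Reasoning

-- A distinct vector over Fin (suc n) either avoids 0 or takes the value 0 at exactly one position v.
∑distinct-suc : ∀ {n} k (g : Vec (Fin (suc n)) (suc k) → ℚ) →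
  ∑distinct (suc n) (suc k) g ≡
  ∑distinct n (suc k) (g ∘ Vec.map Fin.suc) + ∑ (λ v → ∑distinct n k (g ∘ insertMin v))

∑distinct-head-zero : ∀ {n} k (g : Vec (Fin (suc n)) (suc k) → ℚ) →
  ∑vec (suc n) k (λ π → [ Fin.zero ∉ᵇ π ∧ distinct π ]· g (Fin.zero ∷ π)) ≡
  ∑distinct n k (g ∘ insertMin Fin.zero)
∑distinct-head-zero {n} k g = begin
  ∑vec (suc n) k (λ π → [ Fin.zero ∉ᵇ π ∧ distinct π ]· g (Fin.zero ∷ π))
    ≡⟨ ∑vec-cong k (λ π → [∧]· (Fin.zero ∉ᵇ π) (distinct π) _) ⟩
  ∑vec (suc n) k (λ π → [ Fin.zero ∉ᵇ π ]· [ distinct π ]· g (Fin.zero ∷ π))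
    ≡⟨ ∑vec-avoiding-zero k _ ⟩
  ∑vec n k (λ τ → [ distinct (Vec.map Fin.suc τ) ]· g (insertMin Fin.zero τ))
    ≡⟨ ∑vec-cong k (λ τ → cong (λ b → [ b ]· g (insertMin Fin.zero τ)) (distinct-map-suc τ)) ⟩
  ∑distinct n k (g ∘ insertMin Fin.zero) ∎
  where open ≡-Reasoning

∑distinct-head-suc : ∀ {n} k (g : Vec (Fin (suc n)) (suc k) → ℚ) →
  ∑ (λ e → ∑vec (suc n) k (λ π → [ Fin.suc e ∉ᵇ π ∧ distinct π ]· g (Fin.suc e ∷ π))) ≡
  ∑distinct n (suc k) (g ∘ Vec.map Fin.suc) + ∑ (λ v → ∑distinct n k (g ∘ insertMin (Fin.suc v)))
∑distinct-head-suc zero        g = sym (+-identityʳ _)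
∑distinct-head-suc {n} (suc k) g = begin
  ∑ (λ e → ∑vec (suc n) (suc k) (λ π → [ Fin.suc e ∉ᵇ π ∧ distinct π ]· g (Fin.suc e ∷ π)))
    ≡⟨ ∑-cong {n} (λ e → ∑vec-cong (suc k) (λ π →
         [∧]·-swap (Fin.suc e ∉ᵇ π) (distinct π) (g (Fin.suc e ∷ π)))) ⟩
  ∑ (λ e → ∑distinct (suc n) (suc k) (g′ e))
    ≡⟨ ∑-cong {n} (λ e → ∑distinct-suc k (g′ e)) ⟩
  ∑ (λ e → Mapped e + ∑ (Inserted e))
    ≡⟨ ∑-distrib-+ Mapped (λ e → ∑ (Inserted e)) ⟩
  ∑ Mapped + ∑ (λ e → ∑ (Inserted e))
    ≡⟨ cong₂ _+_ (∑-cong {n} Mapped≡) (∑-comm Inserted) ⟩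
  ∑distinct n (suc (suc k)) (g ∘ Vec.map Fin.suc) + ∑ (λ v → ∑ (λ e → Inserted e v))
    ≡⟨ cong (∑distinct n (suc (suc k)) (g ∘ Vec.map Fin.suc) +_)
            (∑-cong {suc k} (λ v → ∑-cong {n} (Inserted≡ v))) ⟩
  ∑distinct n (suc (suc k)) (g ∘ Vec.map Fin.suc) + ∑ (λ v → ∑distinct n (suc k) (g ∘ insertMin (Fin.suc v))) ∎
  where
  open ≡-Reasoning
  g′ : Fin n → Vec (Fin (suc n)) (suc k) → ℚ
  g′ e π = [ Fin.suc e ∉ᵇ π ]· g (Fin.suc e ∷ π)
  Mapped : Fin n → ℚ
  Mapped e = ∑distinct n (suc k) (g′ e ∘ Vec.map Fin.suc)
  Inserted : Fin n → Fin (suc k) → ℚ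
  Inserted e v = ∑distinct n k (g′ e ∘ insertMin v)
  unshift : ∀ {a b} c q → b ≡ a → [ c ]· [ b ]· q ≡ [ a ∧ c ]· q
  unshift {a} c q refl = sym ([∧]·-swap a c q)
  Mapped≡ : ∀ e → Mapped e ≡ ∑vec n (suc k) (λ τ → [ e ∉ᵇ τ ∧ distinct τ ]· g (Vec.map Fin.suc (e ∷ τ)))
  Mapped≡ e = ∑vec-cong (suc k) (λ τ →
    unshift (distinct τ) (g (Vec.map Fin.suc (e ∷ τ))) (suc∉ᵇmap-suc e τ))
  Inserted≡ : ∀ v e →
    Inserted e v ≡ ∑vec n k (λ τ → [ e ∉ᵇ τ ∧ distinct τ ]· g (insertMin (Fin.suc v) (e ∷ τ)))
  Inserted≡ v e = ∑vec-cong k (λ τ →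
    unshift (distinct τ) (g (insertMin (Fin.suc v) (e ∷ τ))) (suc∉ᵇinsertMin e v τ))

∑distinct-suc {n} k g = begin
  T₀ + T₊
    ≡⟨ cong₂ _+_ (∑distinct-head-zero k g) (∑distinct-head-suc k g) ⟩
  Z + (X + Y)
    ≡⟨ solve 3 (λ Z X Y → Z :+ (X :+ Y) := X :+ (Z :+ Y)) refl Z X Y ⟩
  X + (Z + Y) ∎
  where
  open ≡-Reasoning
  T₀ T₊ Z X Y : ℚ
  T₀ = ∑vec (suc n) k (λ π → [ Fin.zero ∉ᵇ π ∧ distinct π ]· g (Fin.zero ∷ π))
  T₊ = ∑ (λ e → ∑vec (suc n) k (λ π → [ Fin.suc e ∉ᵇ π ∧ distinct π ]· g (Fin.suc e ∷ π)))
  Z = ∑distinct n k (g ∘ insertMin Fin.zero)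
  X = ∑distinct n (suc k) (g ∘ Vec.map Fin.suc)
  Y = ∑ (λ v → ∑distinct n k (g ∘ insertMin (Fin.suc v)))

T-∧⁻ : ∀ {a b} → T (a ∧ b) → T a × T b
T-∧⁻ = Boolₚ.T-∧ .Equivalence.to

T-∧⁺ : ∀ {a b} → T a × T b → T (a ∧ b)
T-∧⁺ = Boolₚ.T-∧ .Equivalence.from

∉ᵇ-sound : ∀ {N k} {d : Fin N} (π : Vec (Fin N) k) → T (d ∉ᵇ π) → ∀ u → lookup π u ≢ d
∉ᵇ-sound {d = d} (e ∷ π) d∉π u with e Finₚ.≟ d
∉ᵇ-sound (e ∷ π) d∉π Fin.zero    | no e≢d = e≢d
∉ᵇ-sound (e ∷ π) d∉π (Fin.suc u) | no _   = ∉ᵇ-sound π d∉π u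

∉ᵇ-complete : ∀ {N k} {d : Fin N} (π : Vec (Fin N) k) → (∀ u → lookup π u ≢ d) → T (d ∉ᵇ π)
∉ᵇ-complete         []      _     = _
∉ᵇ-complete {d = d} (e ∷ π) π≢d with e Finₚ.≟ d
... | yes e≡d = π≢d Fin.zero e≡d
... | no  _   = ∉ᵇ-complete π (π≢d ∘ Fin.suc)

distinct⇒injective : ∀ {N k} (π : Vec (Fin N) k) → T (distinct π) → Injective _≡_ _≡_ (lookup π)
distinct⇒injective (d ∷ π) dπ {Fin.zero}  {Fin.zero}  _  = refl
distinct⇒injective (d ∷ π) dπ {Fin.zero}  {Fin.suc v} eq = ⊥-elim (∉ᵇ-sound π (proj₁ (T-∧⁻ dπ)) v (sym eq))
distinct⇒injective (d ∷ π) dπ {Fin.suc u} {Fin.zero}  eq = ⊥-elim (∉ᵇ-sound π (proj₁ (T-∧⁻ dπ)) u eq)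
distinct⇒injective (d ∷ π) dπ {Fin.suc u} {Fin.suc v} eq =
  cong Fin.suc (distinct⇒injective π (proj₂ (T-∧⁻ {d ∉ᵇ π} dπ)) eq)

injective⇒distinct : ∀ {N k} (π : Vec (Fin N) k) → Injective _≡_ _≡_ (lookup π) → T (distinct π)
injective⇒distinct []      _   = _
injective⇒distinct (d ∷ π) inj = T-∧⁺
  ( ∉ᵇ-complete π (λ u eq → 0≢suc (inj (sym eq)))
  , injective⇒distinct π (Finₚ.suc-injective ∘ inj))
  where
  0≢suc : ∀ {n} {u : Fin n} → Fin.zero ≢ Fin.suc u
  0≢suc ()

T-allB-tabulate : ∀ {X : Set} {n} (p : X → Bool) (g : Fin n → X) →
                  T (allB p (tabulate g)) ⇔ (∀ i → T (p (g i)))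
T-allB-tabulate {n = zero}  p g = mk⇔ (λ _ ()) (λ _ → _)
T-allB-tabulate {n = suc n} p g = mk⇔
  (λ all → let (head , tail) = T-∧⁻ all in
           λ { Fin.zero → head ; (Fin.suc i) → T-allB-tabulate p (g ∘ Fin.suc) .Equivalence.to tail i })
  (λ all → T-∧⁺ (all Fin.zero , T-allB-tabulate p (g ∘ Fin.suc) .Equivalence.from (all ∘ Fin.suc)))

isPerm-reflects : ∀ {m} (π : Vec (Fin m) m) → Reflects (Injective _≡_ _≡_ (lookup π)) (isPerm π)
isPerm-reflects {m} π = Reflects.fromEquivalence
  (λ perm {u} {v} → pairwise u v (allᵢ _ .Equivalence.to (allᵢ _ .Equivalence.to perm u) v))
  (λ inj → allᵢ _ .Equivalence.from (λ u → allᵢ _ .Equivalence.from (λ v → pairwise⁻¹ u v inj)))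
  where
  allᵢ : (p : Fin m → Bool) → T (allB p (allFin m)) ⇔ (∀ i → T (p i))
  allᵢ p = T-allB-tabulate p (λ i → i)
  pairwise : ∀ u v → T (not ⌊ lookup π u Finₚ.≟ lookup π v ⌋ ∨ ⌊ u Finₚ.≟ v ⌋) →
             lookup π u ≡ lookup π v → u ≡ v
  pairwise u v ok eq with u Finₚ.≟ v | lookup π u Finₚ.≟ lookup π v
  ... | yes u≡v | _        = u≡v
  ... | no  _   | no πu≢πv = ⊥-elim (πu≢πv eq)
  pairwise⁻¹ : ∀ u v → Injective _≡_ _≡_ (lookup π) →
               T (not ⌊ lookup π u Finₚ.≟ lookup π v ⌋ ∨ ⌊ u Finₚ.≟ v ⌋)
  pairwise⁻¹ u v inj with u Finₚ.≟ v | lookup π u Finₚ.≟ lookup π v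
  ... | yes _   | yes _    = _
  ... | yes _   | no  _    = _
  ... | no  u≢v | yes πu≡πv = ⊥-elim (u≢v (inj πu≡πv))
  ... | no  _   | no  _    = _

distinct-reflects : ∀ {N k} (π : Vec (Fin N) k) → Reflects (Injective _≡_ _≡_ (lookup π)) (distinct π)
distinct-reflects π = Reflects.fromEquivalence (distinct⇒injective π) (injective⇒distinct π)

isPerm≡distinct : ∀ {m} (π : Vec (Fin m) m) → isPerm π ≡ distinct π
isPerm≡distinct π = Reflects.det (isPerm-reflects π) (distinct-reflects π)

distinct-pigeonhole : ∀ {n} (τ : Vec (Fin n) (suc n)) → distinct τ ≡ false
distinct-pigeonhole {n} τ with distinct τ in eq
... | false = refl
... | true  with Finₚ.pigeonhole (ℕₚ.n<1+n n) (lookup τ)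
...   | i , j , i<j , τi≡τj =
  ⊥-elim (Finₚ.<⇒≢ i<j (distinct⇒injective τ (subst T (sym eq) _) τi≡τj))

∑distinct-perm : ∀ {n} (g : Vec (Fin (suc n)) (suc n) → ℚ) →
                 ∑distinct (suc n) (suc n) g ≡ ∑ (λ v → ∑distinct n n (g ∘ insertMin v))
∑distinct-perm {n} g = begin
  ∑distinct (suc n) (suc n) g
    ≡⟨ ∑distinct-suc n g ⟩
  ∑distinct n (suc n) (g ∘ Vec.map Fin.suc) + Z
    ≡⟨ cong (_+ Z) none ⟩
  0ℚ + Z
    ≡⟨ +-identityˡ Z ⟩
  Z ∎
  where
  open ≡-Reasoning
  Z : ℚ
  Z = ∑ (λ v → ∑distinct n n (g ∘ insertMin v))
  none : ∑distinct n (suc n) (g ∘ Vec.map Fin.suc) ≡ 0ℚ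
  none = trans (∑vec-cong (suc n) (λ τ → cong (λ b → [ b ]· g (Vec.map Fin.suc τ)) (distinct-pigeonhole τ)))
               (∑vec-zero n (suc n))

listSum : ∀ {X : Set} → List X → (X → ℚ) → ℚ
listSum xs f = sumℚ (List.map f xs)

listSum-++ : ∀ {X : Set} (xs ys : List X) f → listSum (xs ++ ys) f ≡ listSum xs f + listSum ys f
listSum-++ []       ys f = sym (+-identityˡ _)
listSum-++ (x ∷ xs) ys f = trans (cong (f x +_) (listSum-++ xs ys f)) (sym (+-assoc (f x) _ _))

listSum-concatMap : ∀ {X Y : Set} (h : X → List Y) xs f →
                    listSum (concatMap h xs) f ≡ listSum xs (λ x → listSum (h x) f)
listSum-concatMap h []       f = refl
listSum-concatMap h (x ∷ xs) f =
  trans (listSum-++ (h x) (concatMap h xs) f) (cong (listSum (h x) f +_) (listSum-concatMap h xs f))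

listSum-map : ∀ {X Y : Set} (h : X → Y) xs f → listSum (List.map h xs) f ≡ listSum xs (f ∘ h)
listSum-map h []       f = refl
listSum-map h (x ∷ xs) f = cong (f (h x) +_) (listSum-map h xs f)

listSum-tabulate : ∀ {X : Set} {n} (g : Fin n → X) f → listSum (tabulate g) f ≡ ∑ (f ∘ g)
listSum-tabulate {n = zero}  g f = refl
listSum-tabulate {n = suc n} g f = cong (f (g Fin.zero) +_) (listSum-tabulate (g ∘ Fin.suc) f)

listSum-filter : ∀ {X : Set} (p : X → Bool) xs f → listSum (filterB p xs) f ≡ listSum xs (λ x → [ p x ]· f x)
listSum-filter p []       f = refl
listSum-filter p (x ∷ xs) f with p x
... | true  = cong (f x +_) (listSum-filter p xs f)
... | false = trans (listSum-filter p xs f) (sym (+-identityˡ _))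

listSum-allVecs : ∀ N k f → listSum (allVecs N k) f ≡ ∑vec N k f
listSum-allVecs N zero    f = +-identityʳ (f [])
listSum-allVecs N (suc k) f = begin
  listSum (allVecs N (suc k)) f
    ≡⟨ listSum-concatMap (λ x → List.map (x ∷_) (allVecs N k)) (allFin N) f ⟩
  listSum (allFin N) (λ x → listSum (List.map (x ∷_) (allVecs N k)) f)
    ≡⟨ listSum-tabulate {n = N} (λ x → x) (λ x → listSum (List.map (x ∷_) (allVecs N k)) f) ⟩
  ∑ (λ x → listSum (List.map (x ∷_) (allVecs N k)) f)
    ≡⟨ ∑-cong {N} (λ x → trans (listSum-map (x ∷_) (allVecs N k) f) (listSum-allVecs N k (f ∘ (x ∷_)))) ⟩
  ∑vec N (suc k) f ∎
  where open ≡-Reasoning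

listSum-perms : ∀ m f → listSum (perms m) f ≡ ∑distinct m m f
listSum-perms m f = begin
  listSum (perms m) f
    ≡⟨ listSum-filter isPerm (allVecs m m) f ⟩
  listSum (allVecs m m) (λ π → [ isPerm π ]· f π)
    ≡⟨ listSum-allVecs m m (λ π → [ isPerm π ]· f π) ⟩
  ∑vec m m (λ π → [ isPerm π ]· f π)
    ≡⟨ ∑vec-cong m (λ π → cong (λ b → [ b ]· f π) (isPerm≡distinct π)) ⟩
  ∑distinct m m f ∎
  where open ≡-Reasoning

Graph : ℕ → Set
Graph n = Fin n → Fin n → Bool

removeVertex : ∀ {n} → Graph (suc n) → Fin (suc n) → Graph n
removeVertex G v s t = G (punchIn v s) (punchIn v t)

outDegree : ∀ {n} → Graph n → Fin n → ℕ
outDegree G u = ∑ℕ (indicator ∘ G u)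

isLocalMax : ∀ {n} → Graph n → Vec (Fin n) n → Fin n → Bool
isLocalMax G π u = ⋀ λ t → not (G u t) ∨ (toℕ (lookup π t) <ᵇ toℕ (lookup π u))

weight : ∀ {n} → Graph n → (Fin n → ℚ) → Vec (Fin n) n → ℚ
weight G w π = ∏ λ u → if isLocalMax G π u then w u else 1ℚ

lookup-insertMin : ∀ {n k} (v : Fin (suc k)) (τ : Vec (Fin n) k) → lookup (insertMin v τ) v ≡ Fin.zero
lookup-insertMin Fin.zero    τ       = refl
lookup-insertMin (Fin.suc v) (_ ∷ τ) = lookup-insertMin v τ

lookup-insertMin-punchIn : ∀ {n k} (v : Fin (suc k)) (τ : Vec (Fin n) k) u →
                           lookup (insertMin v τ) (punchIn v u) ≡ Fin.suc (lookup τ u)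
lookup-insertMin-punchIn Fin.zero    τ       u           = Vecₚ.lookup-map u Fin.suc τ
lookup-insertMin-punchIn (Fin.suc v) (e ∷ τ) Fin.zero    = refl
lookup-insertMin-punchIn (Fin.suc v) (e ∷ τ) (Fin.suc u) = lookup-insertMin-punchIn v τ u

⋀-not≡count≡ᵇ0 : ∀ {n} (p : Fin n → Bool) → ⋀ (not ∘ p) ≡ (∑ℕ (indicator ∘ p) ≡ᵇ 0)
⋀-not≡count≡ᵇ0 {zero}  p = refl
⋀-not≡count≡ᵇ0 {suc n} p with p Fin.zero
... | true  = refl
... | false = ⋀-not≡count≡ᵇ0 (p ∘ Fin.suc)

isLocalMax-insertMin : ∀ {n} (G : Graph (suc n)) v (τ : Vec (Fin n) n) →
                       isLocalMax G (insertMin v τ) v ≡ (outDegree G v ≡ᵇ 0)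
isLocalMax-insertMin G v τ rewrite lookup-insertMin v τ =
  trans (⋀-cong (λ t → Boolₚ.∨-identityʳ (not (G v t)))) (⋀-not≡count≡ᵇ0 (G v))

isLocalMax-insertMin-punchIn : ∀ {n} (G : Graph (suc n)) v (τ : Vec (Fin n) n) u →
  isLocalMax G (insertMin v τ) (punchIn v u) ≡ isLocalMax (removeVertex G v) τ u
isLocalMax-insertMin-punchIn G v τ u =
  trans (⋀-remove {i = v} (λ t → not (G (punchIn v u) t) ∨ (rk t <ᵇ rk (punchIn v u))))
        (cong₂ _∧_ beats-v (⋀-cong same-order))
  where
  rk : Fin _ → ℕ
  rk t = toℕ (lookup (insertMin v τ) t)
  beats-v : (not (G (punchIn v u) v) ∨ (rk v <ᵇ rk (punchIn v u))) ≡ true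
  beats-v rewrite lookup-insertMin v τ | lookup-insertMin-punchIn v τ u = Boolₚ.∨-zeroʳ _
  same-order : ∀ t → (not (G (punchIn v u) (punchIn v t)) ∨ (rk (punchIn v t) <ᵇ rk (punchIn v u)))
                   ≡ (not (removeVertex G v u t) ∨ (toℕ (lookup τ t) <ᵇ toℕ (lookup τ u)))
  same-order t rewrite lookup-insertMin-punchIn v τ u | lookup-insertMin-punchIn v τ t = refl

weight-insertMin : ∀ {n} (G : Graph (suc n)) w v (τ : Vec (Fin n) n) →
  weight G w (insertMin v τ) ≡ loneWeight (outDegree G v) (w v) * weight (removeVertex G v) (w ∘ punchIn v) τ
weight-insertMin G w v τ =
  trans (∏-remove {i = v} (λ u → if isLocalMax G (insertMin v τ) u then w u else 1ℚ))
        (cong₂ _*_ (cong (λ b → if b then w v else 1ℚ) (isLocalMax-insertMin G v τ))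
                   (∏-cong (λ u → cong (λ b → if b then w (punchIn v u) else 1ℚ)
                                       (isLocalMax-insertMin-punchIn G v τ u))))

∑weight-suc : ∀ {n} (G : Graph (suc n)) w →
  ∑distinct (suc n) (suc n) (weight G w) ≡
  ∑ (λ v → loneWeight (outDegree G v) (w v) * ∑distinct n n (weight (removeVertex G v) (w ∘ punchIn v)))
∑weight-suc {n} G w = trans (∑distinct-perm (weight G w)) (∑-cong {suc n} (λ v →
  trans (∑vec-cong n (λ τ → cong ([ distinct τ ]·_) (weight-insertMin G w v τ)))
        (∑distinct-*ˡ n (loneWeight (outDegree G v) (w v)) (weight (removeVertex G v) (w ∘ punchIn v)))))

outDegree-punchIn : ∀ {n} (G : Graph (suc n)) v u →
  outDegree G (punchIn v u) ≡ indicator (G (punchIn v u) v) ℕ.+ outDegree (removeVertex G v) u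
outDegree-punchIn G v u = ∑ℕ-remove {i = v} (indicator ∘ G (punchIn v u))

record Admissible {n} (G : Graph n) (w : Fin n → ℚ) : Set where
  field
    side       : Fin n → Bool
    crossing   : ∀ {u t} → G u t ≡ true → side t ≡ not (side u)
    w≥0        : ∀ u → 0ℚ ≤ w u
    w-1-signed : ∀ u → Signed (side u) (w u - 1ℚ)

restrict : ∀ {n} {G : Graph (suc n)} {w} → Admissible G w →
           ∀ v → Admissible (removeVertex G v) (w ∘ punchIn v)
restrict adm v = record
  { side       = side ∘ punchIn v
  ; crossing   = crossing
  ; w≥0        = w≥0 ∘ punchIn v
  ; w-1-signed = w-1-signed ∘ punchIn v
  }
  where open Admissible adm

module KeyInequality {n} {G : Graph (suc n)} {w : Fin (suc n) → ℚ} (adm : Admissible G w) where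
  open Admissible adm

  d : Fin (suc n) → ℕ
  d = outDegree G

  A r c p D : Fin (suc n) → ℚ
  A u = activityFactor (d u) (w u)
  r u = dropRatio (d u) (w u)
  c v = loneWeight (d v) (w v)
  p v = 1ℚ - fromℕ (d v) * r v
  D v = fromℕ (d v) * r v

  t : Fin (suc n) → Fin (suc n) → ℚ
  t v u = [ G u v ]· r u

  P : ℚ
  P = ∏ A

  Q Y R : Fin (suc n) → ℚ
  Q v = ∏ λ u → activityFactor (outDegree (removeVertex G v) u) (w (punchIn v u))
  Y v = ∏ λ u → 1ℚ + t v (punchIn v u)
  R v = ∑ (t v)

  r-signed : ∀ u → Signed (side u) (r u)
  r-signed u = dropRatio-sign (side u) (d u) (w≥0 u) (w-1-signed u)

  t-signed : ∀ v u → Signed (not (side v)) (t v u)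
  t-signed v u with G u v in Guv
  ... | true  = subst (λ b → Signed b (r u)) side-u≡ (r-signed u)
    where
    side-u≡ : side u ≡ not (side v)
    side-u≡ = trans (sym (Boolₚ.not-involutive (side u))) (cong not (sym (crossing Guv)))
  ... | false = signed-0 (not (side v))

  1+t≥0 : ∀ v u → 0ℚ ≤ 1ℚ + t v u
  1+t≥0 v u with G u v
  ... | true  = 1+dropRatio≥0 (d u) (w≥0 u)
  ... | false = nonNegative⁻¹ 1ℚ

  t-self : ∀ v → t v v ≡ 0ℚ
  t-self v with G v v in Gvv
  ... | true  = ⊥-elim (Boolₚ.not-¬ refl (crossing Gvv))
  ... | false = refl

  R≡∑-punchIn : ∀ v → R v ≡ ∑ (λ u → t v (punchIn v u))
  R≡∑-punchIn v = begin
    ∑ (t v)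
      ≡⟨ ∑-remove {i = v} (t v) ⟩
    t v v + ∑ (λ u → t v (punchIn v u))
      ≡⟨ cong (_+ ∑ (λ u → t v (punchIn v u))) (t-self v) ⟩
    0ℚ + ∑ (λ u → t v (punchIn v u))
      ≡⟨ +-identityˡ _ ⟩
    ∑ (λ u → t v (punchIn v u)) ∎
    where open ≡-Reasoning

  A-removeVertex : ∀ v u → activityFactor (outDegree (removeVertex G v) u) (w (punchIn v u))
                           ≡ A (punchIn v u) * (1ℚ + t v (punchIn v u))
  A-removeVertex v u rewrite outDegree-punchIn G v u with G (punchIn v u) v
  ... | true  = activityFactor-pred d′ (w≥0 (punchIn v u))
    where d′ = outDegree (removeVertex G v) u
  ... | false = sym (trans (cong (A′ *_) (+-identityʳ 1ℚ)) (*-identityʳ A′))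
    where A′ = activityFactor (outDegree (removeVertex G v) u) (w (punchIn v u))

  c*Q≡P*p*Y : ∀ v → c v * Q v ≡ P * (p v * Y v)
  c*Q≡P*p*Y v = begin
    c v * Q v
      ≡⟨ cong₂ _*_ (loneWeight≡ (d v) (w≥0 v)) (∏-cong (A-removeVertex v)) ⟩
    (A v * p v) * ∏ (λ u → A (punchIn v u) * (1ℚ + t v (punchIn v u)))
      ≡⟨ cong ((A v * p v) *_) (∏-distrib-* (A ∘ punchIn v) (λ u → 1ℚ + t v (punchIn v u))) ⟩
    (A v * p v) * (A₋ * Y v)
      ≡⟨ solve 4 (λ a p x y → (a :* p) :* (x :* y) := (a :* x) :* (p :* y)) refl (A v) (p v) A₋ (Y v) ⟩
    (A v * A₋) * (p v * Y v)
      ≡⟨ cong (_* (p v * Y v)) (sym (∏-remove {i = v} A)) ⟩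
    P * (p v * Y v) ∎
    where
    open ≡-Reasoning
    A₋ : ℚ
    A₋ = ∏ (A ∘ punchIn v)

  1+R≤Y : ∀ v → 1ℚ + R v ≤ Y v
  1+R≤Y v = subst (λ x → 1ℚ + x ≤ Y v) (sym (R≡∑-punchIn v))
    (1+∑≤∏1+ (not (side v)) (t v ∘ punchIn v) (t-signed v ∘ punchIn v) (1+t≥0 v ∘ punchIn v))

  D*R≤0 : ∀ v → D v * R v ≤ 0ℚ
  D*R≤0 v = opposite-sign⇒*≤0 (side v) D-signed (signed-∑ (not (side v)) (t v) (t-signed v))
    where
    D-signed : Signed (side v) (D v)
    D-signed = subst (Signed (side v)) (*-comm (r v) (fromℕ (d v)))
                     (signed-*-nonNeg (side v) (r-signed v) (fromℕ≥0 (d v)))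

  1+R-D≤p*Y : ∀ v → 1ℚ + (R v - D v) ≤ p v * Y v
  1+R-D≤p*Y v = begin
    1ℚ + (R v - D v)
      ≤⟨ p≤p+q _ (neg-antimono-≤ (D*R≤0 v)) ⟩
    1ℚ + (R v - D v) + - (D v * R v)
      ≡⟨ solve 2 (λ R D → con 1ℚ :+ (R :- D) :+ :- (D :* R) := (con 1ℚ :- D) :* (con 1ℚ :+ R)) refl (R v) (D v) ⟩
    p v * (1ℚ + R v)
      ≤⟨ *-monoˡ-≤-nonNeg (p v) {{nonNegative (1-d*dropRatio≥0 (d v) (w≥0 v))}} (1+R≤Y v) ⟩
    p v * Y v ∎
    where open ≤-Reasoning

  ∑D≡∑R : ∑ D ≡ ∑ R
  ∑D≡∑R = trans (∑-cong (λ v → fromℕ-count*≡∑ (G v) (r v))) (∑-comm (λ v u → [ G v u ]· r v))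

  ∑[1+R-D]≡suc-n : ∑ (λ v → 1ℚ + (R v - D v)) ≡ fromℕ (suc n)
  ∑[1+R-D]≡suc-n = begin
    ∑ (λ v → 1ℚ + (R v - D v))
      ≡⟨ ∑-distrib-+ {suc n} (λ _ → 1ℚ) (λ v → R v - D v) ⟩
    ∑ {suc n} (λ _ → 1ℚ) + ∑ (λ v → R v - D v)
      ≡⟨ cong₂ _+_ (∑-const-1 (suc n)) (∑-distrib-+ {suc n} R (λ v → - D v)) ⟩
    fromℕ (suc n) + (∑ R + ∑ (λ v → - D v))
      ≡⟨ cong (λ x → fromℕ (suc n) + (∑ R + x)) (∑-neg D) ⟩
    fromℕ (suc n) + (∑ R - ∑ D)
      ≡⟨ cong (λ x → fromℕ (suc n) + (∑ R - x)) ∑D≡∑R ⟩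
    fromℕ (suc n) + (∑ R - ∑ R)
      ≡⟨ solve 2 (λ N S → N :+ (S :- S) := N) refl (fromℕ (suc n)) (∑ R) ⟩
    fromℕ (suc n) ∎
    where open ≡-Reasoning

  keyInequality : fromℕ (suc n) * P ≤ ∑ λ v → c v * Q v
  keyInequality = begin
    fromℕ (suc n) * P
      ≡⟨ *-comm (fromℕ (suc n)) P ⟩
    P * fromℕ (suc n)
      ≡⟨ cong (P *_) (sym ∑[1+R-D]≡suc-n) ⟩
    P * ∑ (λ v → 1ℚ + (R v - D v))
      ≤⟨ *-monoˡ-≤-nonNeg P {{nonNegative P≥0}} (∑-mono-≤ 1+R-D≤p*Y) ⟩
    P * ∑ (λ v → p v * Y v)
      ≡⟨ sym (∑-*ˡ P (λ v → p v * Y v)) ⟩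
    ∑ (λ v → P * (p v * Y v))
      ≡⟨ ∑-cong (λ v → sym (c*Q≡P*p*Y v)) ⟩
    ∑ (λ v → c v * Q v) ∎
    where
    open ≤-Reasoning
    P≥0 : 0ℚ ≤ P
    P≥0 = ∏≥0 (λ u → activityFactor≥0 (d u) (w≥0 u))

localMaxima-bound : ∀ n {G : Graph n} {w} → Admissible G w →
  fromℕ (n !) * ∏ (λ u → activityFactor (outDegree G u) (w u)) ≤ ∑distinct n n (weight G w)
localMaxima-bound zero    adm = ≤-refl
localMaxima-bound (suc n) {G} {w} adm = begin
  fromℕ (suc n !) * P
    ≡⟨ cong (_* P) (ℚ-Mult.×1-homo-* (suc n) (n !)) ⟩
  fromℕ (suc n) * fromℕ (n !) * P
    ≡⟨ solve 3 (λ a b c → a :* b :* c := b :* (a :* c)) refl (fromℕ (suc n)) (fromℕ (n !)) P ⟩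
  fromℕ (n !) * (fromℕ (suc n) * P)
    ≤⟨ *-monoˡ-≤-nonNeg (fromℕ (n !)) {{nonNegative (fromℕ≥0 (n !))}} keyInequality ⟩
  fromℕ (n !) * ∑ (λ v → c v * Q v)
    ≡⟨ sym (∑-*ˡ (fromℕ (n !)) (λ v → c v * Q v)) ⟩
  ∑ (λ v → fromℕ (n !) * (c v * Q v))
    ≡⟨ ∑-cong (λ v → solve 3 (λ a b c → a :* (b :* c) := b :* (a :* c)) refl (fromℕ (n !)) (c v) (Q v)) ⟩
  ∑ (λ v → c v * (fromℕ (n !) * Q v))
    ≤⟨ ∑-mono-≤ (λ v → *-monoˡ-≤-nonNeg (c v) {{nonNegative (loneWeight≥0 (d v) (w≥0 v))}}
         (localMaxima-bound n (restrict adm v))) ⟩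
  ∑ (λ v → c v * ∑distinct n n (weight (removeVertex G v) (w ∘ punchIn v)))
    ≡⟨ sym (∑weight-suc G w) ⟩
  ∑distinct (suc n) (suc n) (weight G w) ∎
  where
  open ≤-Reasoning
  open KeyInequality adm
  open Admissible adm

module _ {c ℓ} (M : Monoid c ℓ) where
  open Monoid M using (Carrier; _≈_; _∙_; ∙-congˡ; identityˡ; assoc)
    renaming (sym to ≈-sym; trans to ≈-trans)
  open MonoidSum M using (sum)

  sum-↑ˡ-↑ʳ : ∀ a {b} (f : Fin (a ℕ.+ b) → Carrier) → sum f ≈ sum (f ∘ (_↑ˡ b)) ∙ sum (f ∘ (a ↑ʳ_))
  sum-↑ˡ-↑ʳ zero    f = ≈-sym (identityˡ _)
  sum-↑ˡ-↑ʳ (suc a) f = ≈-trans (∙-congˡ (sum-↑ˡ-↑ʳ a (f ∘ Fin.suc))) (≈-sym (assoc _ _ _))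

∏-↑ˡ-↑ʳ : ∀ a {b} (f : Fin (a ℕ.+ b) → ℚ) → ∏ f ≡ ∏ (f ∘ (_↑ˡ b)) * ∏ (f ∘ (a ↑ʳ_))
∏-↑ˡ-↑ʳ = sum-↑ˡ-↑ʳ (CommutativeMonoid.monoid *-1-commutativeMonoid)

⋀-↑ˡ-↑ʳ : ∀ a {b} (f : Fin (a ℕ.+ b) → Bool) → ⋀ f ≡ ⋀ (f ∘ (_↑ˡ b)) ∧ ⋀ (f ∘ (a ↑ʳ_))
⋀-↑ˡ-↑ʳ = sum-↑ˡ-↑ʳ (CommutativeMonoid.monoid Boolₚ.∧-commutativeMonoid)

∑ℕ-↑ˡ-↑ʳ : ∀ a {b} (f : Fin (a ℕ.+ b) → ℕ) →
           ∑ℕ f ≡ ∑ℕ (f ∘ (_↑ˡ b)) ℕ.+ ∑ℕ (f ∘ (a ↑ʳ_))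
∑ℕ-↑ˡ-↑ʳ = sum-↑ˡ-↑ʳ (CommutativeMonoid.monoid ℕₚ.+-0-commutativeMonoid)

allB-tabulate : ∀ {X : Set} {n} (p : X → Bool) (g : Fin n → X) → allB p (tabulate g) ≡ ⋀ (p ∘ g)
allB-tabulate {n = zero}  p g = refl
allB-tabulate {n = suc n} p g = cong (p (g Fin.zero) ∧_) (allB-tabulate p (g ∘ Fin.suc))

count-tabulate : ∀ {X : Set} {n} (p : X → Bool) (g : Fin n → X) →
                 count p (tabulate g) ≡ ∑ℕ (indicator ∘ p ∘ g)
count-tabulate {n = zero}  p g = refl
count-tabulate {n = suc n} p g with p (g Fin.zero)
... | true  = cong suc (count-tabulate p (g ∘ Fin.suc))
... | false = count-tabulate p (g ∘ Fin.suc)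

^-count-tabulate : ∀ {X : Set} {n} z (p : X → Bool) (g : Fin n → X) →
                   z ^ count p (tabulate g) ≡ ∏ (λ i → if p (g i) then z else 1ℚ)
^-count-tabulate {n = zero}  z p g = refl
^-count-tabulate {n = suc n} z p g with p (g Fin.zero)
... | true  = cong (z *_) (^-count-tabulate z p (g ∘ Fin.suc))
... | false = trans (^-count-tabulate z p (g ∘ Fin.suc)) (sym (*-identityˡ _))

prodℚ-tabulate : ∀ {X : Set} {n} (f : X → ℚ) (g : Fin n → X) →
                 prodℚ (List.map f (tabulate g)) ≡ ∏ (f ∘ g)
prodℚ-tabulate {n = zero}  f g = refl
prodℚ-tabulate {n = suc n} f g = cong (f (g Fin.zero) *_) (prodℚ-tabulate f (g ∘ Fin.suc))

module Bipartite {a b : ℕ} (H : BipGraph a b) where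

  arc : Fin a ⊎ Fin b → Fin a ⊎ Fin b → Bool
  arc (inj₁ i) (inj₂ j) = adj H i j
  arc (inj₂ j) (inj₁ i) = adj H i j
  arc (inj₁ _) (inj₁ _) = false
  arc (inj₂ _) (inj₂ _) = false

  G : Graph (a ℕ.+ b)
  G u t = arc (splitAt a u) (splitAt a t)

  G-AA : ∀ i i′ → G (i ↑ˡ b) (i′ ↑ˡ b) ≡ false
  G-AA i i′ rewrite Finₚ.splitAt-↑ˡ a i b | Finₚ.splitAt-↑ˡ a i′ b = refl

  G-AB : ∀ i j → G (i ↑ˡ b) (a ↑ʳ j) ≡ adj H i j
  G-AB i j rewrite Finₚ.splitAt-↑ˡ a i b | Finₚ.splitAt-↑ʳ a b j = refl

  G-BA : ∀ j i → G (a ↑ʳ j) (i ↑ˡ b) ≡ adj H i j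
  G-BA j i rewrite Finₚ.splitAt-↑ˡ a i b | Finₚ.splitAt-↑ʳ a b j = refl

  G-BB : ∀ j j′ → G (a ↑ʳ j) (a ↑ʳ j′) ≡ false
  G-BB j j′ rewrite Finₚ.splitAt-↑ʳ a b j | Finₚ.splitAt-↑ʳ a b j′ = refl

  module _ (π : Vec (Fin (a ℕ.+ b)) (a ℕ.+ b)) where
    private
      rk : Fin (a ℕ.+ b) → ℕ
      rk t = toℕ (lookup π t)
      below : Fin (a ℕ.+ b) → Bool → Fin (a ℕ.+ b) → Bool
      below u g t = not g ∨ (rk t <ᵇ rk u)

    isLocalMax-A : ∀ i → isLocalMax G π (i ↑ˡ b) ≡ internallyActive H π i
    isLocalMax-A i = begin
      isLocalMax G π u
        ≡⟨ ⋀-↑ˡ-↑ʳ a (λ t → below u (G u t) t) ⟩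
      ⋀ (λ i′ → below u (G u (i′ ↑ˡ b)) (i′ ↑ˡ b)) ∧ ⋀ (λ j → below u (G u (a ↑ʳ j)) (a ↑ʳ j))
        ≡⟨ cong₂ _∧_ (trans (⋀-cong (λ i′ → cong (λ g → below u g (i′ ↑ˡ b)) (G-AA i i′))) (⋀-true a))
             (⋀-cong (λ j → cong (λ g → below u g (a ↑ʳ j)) (G-AB i j))) ⟩
      ⋀ (λ j → below u (adj H i j) (a ↑ʳ j))
        ≡⟨ sym (allB-tabulate (λ j → below u (adj H i j) (a ↑ʳ j)) (λ j → j)) ⟩
      internallyActive H π i ∎
      where
      open ≡-Reasoning
      u : Fin (a ℕ.+ b)
      u = i ↑ˡ b

    isLocalMax-B : ∀ j → isLocalMax G π (a ↑ʳ j) ≡ externallyActive H π j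
    isLocalMax-B j = begin
      isLocalMax G π u
        ≡⟨ ⋀-↑ˡ-↑ʳ a (λ t → below u (G u t) t) ⟩
      ⋀ (λ i → below u (G u (i ↑ˡ b)) (i ↑ˡ b)) ∧ ⋀ (λ j′ → below u (G u (a ↑ʳ j′)) (a ↑ʳ j′))
        ≡⟨ cong₂ _∧_ (⋀-cong (λ i → cong (λ g → below u g (i ↑ˡ b)) (G-BA j i)))
             (trans (⋀-cong (λ j′ → cong (λ g → below u g (a ↑ʳ j′)) (G-BB j j′))) (⋀-true b)) ⟩
      ⋀ (λ i → below u (adj H i j) (i ↑ˡ b)) ∧ true
        ≡⟨ Boolₚ.∧-identityʳ _ ⟩
      ⋀ (λ i → below u (adj H i j) (i ↑ˡ b))
        ≡⟨ sym (allB-tabulate (λ i → below u (adj H i j) (i ↑ˡ b)) (λ i → i)) ⟩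
      externallyActive H π j ∎
      where
      open ≡-Reasoning
      u : Fin (a ℕ.+ b)
      u = a ↑ʳ j

  outDegree-A : ∀ i → outDegree G (i ↑ˡ b) ≡ degA H i
  outDegree-A i = begin
    outDegree G u
      ≡⟨ ∑ℕ-↑ˡ-↑ʳ a (λ t → indicator (G u t)) ⟩
    ∑ℕ (λ i′ → indicator (G u (i′ ↑ˡ b))) ℕ.+ ∑ℕ (λ j → indicator (G u (a ↑ʳ j)))
      ≡⟨ cong₂ ℕ._+_ (trans (∑ℕ-cong (λ i′ → cong indicator (G-AA i i′))) (∑ℕ-zero a))
           (∑ℕ-cong (λ j → cong indicator (G-AB i j))) ⟩
    ∑ℕ (λ j → indicator (adj H i j))
      ≡⟨ sym (count-tabulate (adj H i) (λ j → j)) ⟩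
    degA H i ∎
    where
    open ≡-Reasoning
    u : Fin (a ℕ.+ b)
    u = i ↑ˡ b

  outDegree-B : ∀ j → outDegree G (a ↑ʳ j) ≡ degB H j
  outDegree-B j = begin
    outDegree G u
      ≡⟨ ∑ℕ-↑ˡ-↑ʳ a (λ t → indicator (G u t)) ⟩
    ∑ℕ (λ i → indicator (G u (i ↑ˡ b))) ℕ.+ ∑ℕ (λ j′ → indicator (G u (a ↑ʳ j′)))
      ≡⟨ cong₂ ℕ._+_ (∑ℕ-cong (λ i → cong indicator (G-BA j i)))
           (trans (∑ℕ-cong (λ j′ → cong indicator (G-BB j j′))) (∑ℕ-zero b)) ⟩
    ∑ℕ (λ i → indicator (adj H i j)) ℕ.+ 0
      ≡⟨ ℕₚ.+-identityʳ _ ⟩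
    ∑ℕ (λ i → indicator (adj H i j))
      ≡⟨ sym (count-tabulate (λ i → adj H i j) (λ i → i)) ⟩
    degB H j ∎
    where
    open ≡-Reasoning
    u : Fin (a ℕ.+ b)
    u = a ↑ʳ j

  module _ (x y : ℚ) where

    w : Fin (a ℕ.+ b) → ℚ
    w u = [ const x , const y ]′ (splitAt a u)

    w-A : ∀ i → w (i ↑ˡ b) ≡ x
    w-A i rewrite Finₚ.splitAt-↑ˡ a i b = refl

    w-B : ∀ j → w (a ↑ʳ j) ≡ y
    w-B j rewrite Finₚ.splitAt-↑ʳ a b j = refl

    weight≡ : ∀ π → weight G w π ≡ x ^ ia H π * y ^ ea H π
    weight≡ π = begin
      weight G w π
        ≡⟨ ∏-↑ˡ-↑ʳ a (λ u → if isLocalMax G π u then w u else 1ℚ) ⟩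
      ∏ (λ i → if isLocalMax G π (i ↑ˡ b) then w (i ↑ˡ b) else 1ℚ)
        * ∏ (λ j → if isLocalMax G π (a ↑ʳ j) then w (a ↑ʳ j) else 1ℚ)
        ≡⟨ cong₂ _*_ (∏-cong (λ i → cong₂ (λ l z → if l then z else 1ℚ) (isLocalMax-A π i) (w-A i)))
             (∏-cong (λ j → cong₂ (λ l z → if l then z else 1ℚ) (isLocalMax-B π j) (w-B j))) ⟩
      ∏ (λ i → if internallyActive H π i then x else 1ℚ) * ∏ (λ j → if externallyActive H π j then y else 1ℚ)
        ≡⟨ sym (cong₂ _*_ (^-count-tabulate x (internallyActive H π) (λ i → i))
                          (^-count-tabulate y (externallyActive H π) (λ j → j))) ⟩
      x ^ ia H π * y ^ ea H π ∎
      where open ≡-Reasoning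

    lowerBound≡ : lowerBound H x y ≡ ∏ (λ u → activityFactor (outDegree G u) (w u))
    lowerBound≡ = sym (begin
      ∏ (λ u → activityFactor (outDegree G u) (w u))
        ≡⟨ ∏-↑ˡ-↑ʳ a (λ u → activityFactor (outDegree G u) (w u)) ⟩
      ∏ (λ i → activityFactor (outDegree G (i ↑ˡ b)) (w (i ↑ˡ b)))
        * ∏ (λ j → activityFactor (outDegree G (a ↑ʳ j)) (w (a ↑ʳ j)))
        ≡⟨ cong₂ _*_ (∏-cong (λ i → cong₂ activityFactor (outDegree-A i) (w-A i)))
             (∏-cong (λ j → cong₂ activityFactor (outDegree-B j) (w-B j))) ⟩
      ∏ (λ i → activityFactor (degA H i) x) * ∏ (λ j → activityFactor (degB H j) y)
        ≡⟨ sym (cong₂ _*_ (prodℚ-tabulate (λ i → activityFactor (degA H i) x) (λ i → i))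
             (prodℚ-tabulate (λ j → activityFactor (degB H j) y) (λ j → j))) ⟩
      lowerBound H x y ∎)
      where open ≡-Reasoning

    Ttilde≡ : Ttilde H x y ≡ inv-m! H * ∑distinct (a ℕ.+ b) (a ℕ.+ b) (weight G w)
    Ttilde≡ = cong (inv-m! H *_) (trans (listSum-perms (a ℕ.+ b) _)
                                        (∑vec-cong (a ℕ.+ b) (λ π → cong ([ distinct π ]·_) (sym (weight≡ π)))))

    bipartite-bound : Admissible G w → lowerBound H x y ≤ Ttilde H x y
    bipartite-bound adm = begin
      lowerBound H x y
        ≡⟨ lowerBound≡ ⟩
      LB
        ≡⟨ sym (*-identityˡ LB) ⟩
      1ℚ * LB
        ≡⟨ cong (_* LB) (sym (trans (*-comm (inv-m! H) (fromℕ (m !))) (fromℕ*1/n≡1 (m !) {{m !≢0}}))) ⟩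
      inv-m! H * fromℕ (m !) * LB
        ≡⟨ *-assoc (inv-m! H) (fromℕ (m !)) LB ⟩
      inv-m! H * (fromℕ (m !) * LB)
        ≤⟨ *-monoˡ-≤-nonNeg (inv-m! H) {{normalize-nonNeg 1 (m !) {{m !≢0}}}} (localMaxima-bound m adm) ⟩
      inv-m! H * ∑distinct m m (weight G w)
        ≡⟨ sym Ttilde≡ ⟩
      Ttilde H x y ∎
      where
      open ≤-Reasoning
      m : ℕ
      m = a ℕ.+ b
      LB : ℚ
      LB = ∏ (λ u → activityFactor (outDegree G u) (w u))

    bipartite-admissible : ∀ s → 0ℚ ≤ x → 0ℚ ≤ y → Signed s (x - 1ℚ) → Signed (not s) (y - 1ℚ) →
                           Admissible G w
    bipartite-admissible s 0≤x 0≤y sx sy = record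
      { side       = side ∘ splitAt a
      ; crossing   = λ {u} {t} → crossing (splitAt a u) (splitAt a t)
      ; w≥0        = w≥0 ∘ splitAt a
      ; w-1-signed = signed ∘ splitAt a
      }
      where
      side : Fin a ⊎ Fin b → Bool
      side = [ const s , const (not s) ]′
      crossing : ∀ e e′ → arc e e′ ≡ true → side e′ ≡ not (side e)
      crossing (inj₁ _) (inj₂ _) _ = refl
      crossing (inj₂ _) (inj₁ _) _ = sym (Boolₚ.not-involutive s)
      w≥0 : ∀ e → 0ℚ ≤ [ const x , const y ]′ e
      w≥0 (inj₁ _) = 0≤x
      w≥0 (inj₂ _) = 0≤y
      signed : ∀ e → Signed (side e) ([ const x , const y ]′ e - 1ℚ)
      signed (inj₁ _) = sx
      signed (inj₂ _) = sy

p≤1⇒p-1≤0 : ∀ {p} → p ≤ 1ℚ → p - 1ℚ ≤ 0ℚ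
p≤1⇒p-1≤0 = +-monoˡ-≤ (- 1ℚ)

1≤p⇒0≤p-1 : ∀ {p} → 1ℚ ≤ p → 0ℚ ≤ p - 1ℚ
1≤p⇒0≤p-1 = +-monoˡ-≤ (- 1ℚ)

1≤p⇒0≤p : ∀ {p} → 1ℚ ≤ p → 0ℚ ≤ p
1≤p⇒0≤p = ≤-trans (nonNegative⁻¹ 1ℚ)

mainTheorem11 : {a b : ℕ} (H : BipGraph a b) (x y : ℚ) →
    ((0ℚ ≤ x × x ≤ 1ℚ × 1ℚ ≤ y) ⊎ (0ℚ ≤ y × y ≤ 1ℚ × 1ℚ ≤ x)) →
    lowerBound H x y ≤ Ttilde H x y
mainTheorem11 H x y (inj₁ (0≤x , x≤1 , 1≤y)) =
  bipartite-bound x y (bipartite-admissible x y true 0≤x (1≤p⇒0≤p 1≤y) (p≤1⇒p-1≤0 x≤1) (1≤p⇒0≤p-1 1≤y))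
  where open Bipartite H
mainTheorem11 H x y (inj₂ (0≤y , y≤1 , 1≤x)) =
  bipartite-bound x y (bipartite-admissible x y false (1≤p⇒0≤p 1≤x) 0≤y (1≤p⇒0≤p-1 1≤x) (p≤1⇒p-1≤0 y≤1))
  where open Bipartite H
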